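{- If $c\geq 2$, then $\mathit{fw}(I_{c}D_{c}I_{c})=c+3$.
   Context: A sequence $s$ contains a sequence $u$ if some subsequence of $s$ can be changed into $u$ by a one-to-one renaming of its letters. An $(r,s)$-formation is a concatenation of $s$ permutations of the same set of $r$ distinct letters. The formation width $\mathit{fw}(u)$ is the minimum $s$ such that there exists $r$ for which every $(r,s)$-formation contains $u$. $I_c$ denotes $1\,2\ldots c$ and $D_c$ denotes $c\,(c-1)\ldots 1$. -}

module Defs where

open import Data.Nat using (ℕ; suc; _<_)
open import Data.List using (List; map; concat; length; applyUpTo; reverse; _++_)
open import Data.List.Membership.Propositional using (_∈_)
open import Data.List.Relation.Binary.Sublist.Propositional using (_⊆_)
open import Data.List.Relation.Binary.Permutation.Propositional using (_↭_)
open import Data.List.Relation.Unary.All using (All)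
open import Data.List.Relation.Unary.Unique.Propositional using (Unique)
open import Data.Product using (Σ; _×_)
open import Relation.Binary.PropositionalEquality using (_≡_)
open import Relation.Nullary using (¬_)

Contains : List ℕ → List ℕ → Set
Contains s u =
  Σ (List ℕ) λ t → (t ⊆ s) ×
    Σ (ℕ → ℕ) λ f →
      (∀ {x y} → x ∈ t → y ∈ t → f x ≡ f y → x ≡ y) × (map f t ≡ u)

IsFormation : ℕ → ℕ → List ℕ → Set
IsFormation r s w =
  Σ (List ℕ) λ L → Unique L × (length L ≡ r) ×
    Σ (List (List ℕ)) λ ps →
      (length ps ≡ s) × All (_↭ L) ps × (concat ps ≡ w)

Forces : List ℕ → ℕ → Set
Forces u s = Σ ℕ λ r → ∀ w → IsFormation r s w → Contains w u

FormationWidth : List ℕ → ℕ → Set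
FormationWidth u n = Forces u n × (∀ m → m < n → ¬ Forces u m)

I : ℕ → List ℕ
I c = applyUpTo suc c

D : ℕ → List ℕ
D c = reverse (I c)

module Submission where

-- In an (r, c + 3)-formation P₁ P₂ … P_{c+3} with r = tower c (c + 2), Erdős–Szekeres,
-- applied once for each of P₂ … P_{c+3} to the positions of the letters, yields c letters S, in the
-- order of P₁, that each later block lists either in order (a forward block) or in reverse (a backward
-- block). A backward block followed by a forward one gives S Sʳ S directly. Otherwise the later blocks
-- are a forward blocks followed by b backward ones, a + b = c + 2. If a ≥ 1 and b ≥ 2, write
-- reverse S = z ∷ R ++ Q with |R| < a and |Q| < b − 1; the rearrangement X = reverse Q ++ z ∷ R of S
-- then has X Xʳ X inside P₁ and the later blocks, the letters of R and of reverse Q each going into a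
-- block of their own. If a = 0 or b ≤ 1, X = S works in the same way.
--
-- Take the first m < c + 3 blocks of I I D … D (c copies of D = reverse I). A subsequence
-- of I I has at most one adjacent non-ascent, one of D … D at most c − 1 adjacent non-descents. For X
-- of length c, nonAscents X + nonDescents X ≥ c − 1, and both junctions X|Xʳ and Xʳ|X repeat a letter,
-- so count as a non-ascent and as a non-descent; wherever X Xʳ X is cut into the two parts, one of the
-- bounds fails.

open import Data.Empty using (⊥; ⊥-elim)
open import Data.List
  using (List; []; _∷_; _++_; [_]; length; map; concat; reverse; replicate; filter; take; drop;
         applyUpTo; upTo)
open import Data.List.Properties
  using (unfold-reverse; reverse-++; reverse-involutive; length-reverse; length-++; length-take;
         take++drop≡id; map-++; reverse-map; concat-++; ++-assoc; ++-identityʳ; ∷-injective;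
         ∷-injectiveˡ; length-replicate; length-upTo; length-map; length-applyUpTo; map-cong-local;
         filter-accept; filter-reject)
open import Data.List.Membership.Propositional using (_∈_)
open import Data.List.Relation.Unary.Any using (here; there)
import Data.List.Relation.Unary.Any.Properties as Any
open import Data.List.Relation.Unary.All as All using (All; []; _∷_)
import Data.List.Relation.Unary.All.Properties as All
open import Data.List.Relation.Unary.AllPairs as AllPairs using (AllPairs; []; _∷_)
import Data.List.Relation.Unary.AllPairs.Properties as AllPairs
open import Data.List.Relation.Unary.Unique.Propositional using (Unique)
import Data.List.Relation.Unary.Unique.Propositional.Properties as Unique
open import Data.List.Relation.Binary.Sublist.Propositional
  using (_⊆_; []; _∷_; _∷ʳ_; ⊆-refl; ⊆-trans; minimum; from∈)
open import Data.List.Relation.Binary.Sublist.Propositional.Properties as Sublist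
  using (All-resp-⊆; Any-resp-⊆; ++⁺; ++⁺ˡ; ++⁺ʳ; filter-⊆; take-⊆)
open import Data.List.Relation.Binary.Permutation.Propositional
  using (_↭_; ↭-sym; ↭-trans; ↭-refl; ↭⇒↭ₛ)
open import Data.List.Relation.Binary.Permutation.Propositional.Properties as Permutation
  using (All-resp-↭; ∈-resp-↭; ↭-length; ↭-reverse)
import Data.List.Relation.Binary.Permutation.Setoid.Properties as PermutationSetoid
open import Data.List.Reverse using (reverseView; []; _∶_∶ʳ_)
open import Data.Nat
  using (ℕ; zero; suc; pred; _+_; _^_; _≤_; _<_; _>_; z≤n; s≤s; s≤s⁻¹; z<s; _≟_; _≤?_; _<?_)
open import Data.Nat.Properties
open import Algebra.Properties.CommutativeSemigroup +-commutativeSemigroup using (interchange)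
open import Data.Product using (Σ-syntax; _×_; _,_)
open import Data.Sum using (_⊎_; inj₁; inj₂)
open import Function using (_∘_; flip; _on_)
open import Relation.Binary.Definitions using (Decidable; Reflexive)
open import Relation.Binary.PropositionalEquality
  using (_≡_; _≢_; refl; sym; trans; cong; cong₂; subst; subst₂; setoid; module ≡-Reasoning)
open import Relation.Nullary using (¬_; Dec; yes; no)

open import Defs

variable
  A B : Set
  x z : A
  xs ys : List A

AllPairs-resp-⊇ : ∀ {R : A → A → Set} → xs ⊆ ys → AllPairs R ys → AllPairs R xs
AllPairs-resp-⊇ []             []         = []
AllPairs-resp-⊇ (_ ∷ʳ xs⊆ys)   (_ ∷ rys)  = AllPairs-resp-⊇ xs⊆ys rys
AllPairs-resp-⊇ (refl ∷ xs⊆ys) (ry ∷ rys) = All-resp-⊆ xs⊆ys ry ∷ AllPairs-resp-⊇ xs⊆ys rys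

AllPairs-map-All : ∀ {Q : A → Set} {R S : A → A → Set} → (∀ {x y} → Q x → Q y → R x y → S x y) →
                   All Q xs → AllPairs R xs → AllPairs S xs
AllPairs-map-All f []         []         = []
AllPairs-map-All f (qx ∷ qxs) (rx ∷ rxs) =
  All.zipWith (λ (qy , rxy) → f qx qy rxy) (qxs , rx) ∷ AllPairs-map-All f qxs rxs

All-reverse⁺ : ∀ {P : A → Set} → All P xs → All P (reverse xs)
All-reverse⁺ {xs = xs} = All-resp-↭ (↭-sym (↭-reverse xs))

AllPairs-reverse⁺ : ∀ {R : A → A → Set} → AllPairs R xs → AllPairs (flip R) (reverse xs)
AllPairs-reverse⁺ {xs = []}     []         = []
AllPairs-reverse⁺ {xs = x ∷ xs} (rx ∷ rxs) rewrite unfold-reverse x xs =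
  AllPairs.++⁺ (AllPairs-reverse⁺ rxs) ([] ∷ []) (All.map (_∷ []) (All-reverse⁺ rx))

Unique-resp-↭ : xs ↭ ys → Unique xs → Unique ys
Unique-resp-↭ p = PermutationSetoid.Unique-resp-↭ (setoid _) (↭⇒↭ₛ p)

all-∈ : ∀ (xs : List A) → All (_∈ xs) xs
all-∈ xs = All.tabulate (λ x∈xs → x∈xs)

∷-of-length-suc : ∀ {n} (xs : List A) → length xs ≡ suc n →
                  Σ[ z ∈ A ] Σ[ T ∈ List A ] xs ≡ z ∷ T × length T ≡ n
∷-of-length-suc (z ∷ T) |T|≡ = z , T , refl , suc-injective |T|≡

split-≤-+ : ∀ m {n} (T : List A) → length T ≤ m + n →
            Σ[ R ∈ List A ] Σ[ Q ∈ List A ] T ≡ R ++ Q × length R ≤ m × length Q ≤ n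
split-≤-+ zero    T       |T|≤       = [] , T , refl , z≤n , |T|≤
split-≤-+ (suc m) []      _          = [] , [] , refl , z≤n , z≤n
split-≤-+ (suc m) (t ∷ T) (s≤s |T|≤) with R , Q , refl , |R|≤ , |Q|≤ ← split-≤-+ m T |T|≤ =
  t ∷ R , Q , refl , s≤s |R|≤ , |Q|≤

⊆-++⁻ : ∀ (xs ys : List A) {q} → q ⊆ xs ++ ys →
        Σ[ q₁ ∈ List A ] Σ[ q₂ ∈ List A ] q ≡ q₁ ++ q₂ × q₁ ⊆ xs × q₂ ⊆ ys
⊆-++⁻ []       ys q⊆ys = [] , _ , refl , [] , q⊆ys
⊆-++⁻ (x ∷ xs) ys (.x ∷ʳ q⊆) with q₁ , q₂ , refl , q₁⊆ , q₂⊆ ← ⊆-++⁻ xs ys q⊆ =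
  q₁ , q₂ , refl , x ∷ʳ q₁⊆ , q₂⊆
⊆-++⁻ (x ∷ xs) ys (refl ∷ q⊆) with q₁ , q₂ , refl , q₁⊆ , q₂⊆ ← ⊆-++⁻ xs ys q⊆ =
  x ∷ q₁ , q₂ , refl , refl ∷ q₁⊆ , q₂⊆

concat-++⁺ : ∀ {xs ys : List A} As Bs → xs ⊆ concat As → ys ⊆ concat Bs → xs ++ ys ⊆ concat (As ++ Bs)
concat-++⁺ As Bs xs⊆ ys⊆ = subst (_ ⊆_) (concat-++ As Bs) (++⁺ xs⊆ ys⊆)

concat-take-⊆ : ∀ n (xss : List (List A)) → concat (take n xss) ⊆ concat xss
concat-take-⊆ n xss =
  subst (concat (take n xss) ⊆_) (trans (concat-++ (take n xss) (drop n xss)) (cong concat (take++drop≡id n xss)))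
        (++⁺ʳ (concat (drop n xss)) ⊆-refl)

++-split : ∀ (xs ys : List A) {p q} → xs ++ ys ≡ p ++ q →
  (Σ[ m ∈ List A ] p ≡ xs ++ m × ys ≡ m ++ q) ⊎ (Σ[ m ∈ List A ] xs ≡ p ++ m × q ≡ m ++ ys)
++-split []       ys {p}     eq = inj₁ (p , refl , eq)
++-split (x ∷ xs) ys {[]}    eq = inj₂ (x ∷ xs , refl , sym eq)
++-split (x ∷ xs) ys {y ∷ p} eq with refl , eq′ ← ∷-injective eq with ++-split xs ys {p} eq′
... | inj₁ (m , refl , ys≡) = inj₁ (m , refl , ys≡)
... | inj₂ (m , refl , q≡)  = inj₂ (m , refl , q≡)

++-split₃ : ∀ (xs ys zs : List A) {p q} → xs ++ ys ++ zs ≡ p ++ q →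
    (Σ[ m ∈ List A ] q ≡ m ++ ys ++ zs)
  ⊎ (Σ[ y₁ ∈ List A ] Σ[ y₂ ∈ List A ] ys ≡ y₁ ++ y₂ × p ≡ xs ++ y₁ × q ≡ y₂ ++ zs)
  ⊎ (Σ[ m ∈ List A ] p ≡ xs ++ ys ++ m)
++-split₃ xs ys zs eq with ++-split xs (ys ++ zs) eq
... | inj₂ (m , _ , q≡) = inj₁ (m , q≡)
... | inj₁ (m , p≡ , ys++zs≡) with ++-split ys zs ys++zs≡
...   | inj₂ (m′ , ys≡ , q≡) = inj₂ (inj₁ (m , m′ , ys≡ , p≡ , q≡))
...   | inj₁ (m′ , m≡ , _)   = inj₂ (inj₂ (m′ , trans p≡ (cong (xs ++_) m≡)))

map-++⁻ : ∀ (f : A → B) t {u v} → map f t ≡ u ++ v →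
          Σ[ t₁ ∈ List A ] Σ[ t₂ ∈ List A ] t ≡ t₁ ++ t₂ × map f t₁ ≡ u × map f t₂ ≡ v
map-++⁻ f t       {[]}    eq = [] , t , refl , refl , eq
map-++⁻ f (x ∷ t) {_ ∷ u} eq
  with fx≡ , eq′ ← ∷-injective eq
  with t₁ , t₂ , refl , t₁↦ , t₂↦ ← map-++⁻ f t {u} eq′ =
  x ∷ t₁ , t₂ , refl , cong₂ _∷_ fx≡ t₁↦ , t₂↦

map-injective-on : ∀ (f : A → B) {t} → (∀ {x y} → x ∈ t → y ∈ t → f x ≡ f y → x ≡ y) →
                   All (_∈ t) xs → All (_∈ t) ys → map f xs ≡ map f ys → xs ≡ ys
map-injective-on f inj []         []         eq = refl
map-injective-on f inj (x∈ ∷ xs∈) (y∈ ∷ ys∈) eq with fx≡fy , eq′ ← ∷-injective eq =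
  cong₂ _∷_ (inj x∈ y∈ fx≡fy) (map-injective-on f inj xs∈ ys∈ eq′)

m+n≡2+o⇒o<m : ∀ {m n o} → m + n ≡ 2 + o → n ≤ 1 → o < m
m+n≡2+o⇒o<m {m} {n} {o} m+n≡ n≤1 = ≤-pred (begin
  suc (suc o) ≡⟨ m+n≡ ⟨
  m + n       ≤⟨ +-monoʳ-≤ m n≤1 ⟩
  m + 1       ≡⟨ +-comm m 1 ⟩
  suc m       ∎)
  where open ≤-Reasoning

-- position of the first occurrence of x in P (length P if there is none)
index : List ℕ → ℕ → ℕ
index []      x = 0
index (z ∷ P) x with x ≟ z
... | yes _ = 0
... | no  _ = suc (index P x)

index-head : ∀ z P → index (z ∷ P) z ≡ 0
index-head z P with z ≟ z
... | yes _  = refl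
... | no z≢z = ⊥-elim (z≢z refl)

index-tail : ∀ {x z} P → x ≢ z → index (z ∷ P) x ≡ suc (index P x)
index-tail {x} {z} P x≢z with x ≟ z
... | yes x≡z = ⊥-elim (x≢z x≡z)
... | no  _   = refl

∈-tail : ∀ {P : List A} → x ∈ z ∷ P → x ≢ z → x ∈ P
∈-tail (here x≡z)  x≢z = ⊥-elim (x≢z x≡z)
∈-tail (there x∈P) _   = x∈P

index-injective : ∀ {P x y} → x ∈ P → y ∈ P → index P x ≡ index P y → x ≡ y
index-injective {z ∷ P} {x} {y} x∈ y∈ eq with x ≟ z | y ≟ z
... | yes refl | yes refl = refl
... | yes _    | no _     = ⊥-elim (0≢1+n eq)
... | no _     | yes _    = ⊥-elim (0≢1+n (sym eq))
... | no x≢z   | no y≢z   = index-injective (∈-tail x∈ x≢z) (∈-tail y∈ y≢z) (suc-injective eq)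

index-<⇒≢ : ∀ {z w y} P → index (z ∷ P) w < index (z ∷ P) y → y ≢ z
index-<⇒≢ {z} {w} P lt refl = n≮0 (subst (index (z ∷ P) w <_) (index-head z P) lt)

index-<-tail : ∀ {z u v} P → u ≢ z → index (z ∷ P) u < index (z ∷ P) v → index P u < index P v
index-<-tail P u≢z lt = s≤s⁻¹ (subst₂ _<_ (index-tail P u≢z) (index-tail P (index-<⇒≢ P lt)) lt)

All-∈-tail : ∀ {P : List A} → All (_∈ z ∷ P) xs → All (_≢ z) xs → All (_∈ P) xs
All-∈-tail xs∈ xs≢z = All.zipWith (λ (x∈ , x≢z) → ∈-tail x∈ x≢z) (xs∈ , xs≢z)

AllPairs-index-tail : ∀ {z xs} P → AllPairs (_<_ on index (z ∷ P)) xs → All (_≢ z) xs →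
                      AllPairs (_<_ on index P) xs
AllPairs-index-tail P []         []           = []
AllPairs-index-tail P (x< ∷ xs<) (x≢z ∷ xs≢z) =
  All.map (index-<-tail P x≢z) x< ∷ AllPairs-index-tail P xs< xs≢z

⊆-of-index-increasing : ∀ P {xs} → All (_∈ P) xs → AllPairs (_<_ on index P) xs → xs ⊆ P
⊆-of-index-increasing []      []         []  = []
⊆-of-index-increasing (z ∷ P) []         []  = minimum (z ∷ P)
⊆-of-index-increasing (z ∷ P) {x ∷ xs} (x∈ ∷ xs∈) (x< ∷ xs<) with z ≟ x
... | yes refl = refl ∷ ⊆-of-index-increasing P (All-∈-tail xs∈ xs≢z) (AllPairs-index-tail P xs< xs≢z)
  where
  xs≢z : All (_≢ z) xs
  xs≢z = All.map (index-<⇒≢ P) x<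
... | no z≢x =
  z ∷ʳ ⊆-of-index-increasing P (All-∈-tail (x∈ ∷ xs∈) x∷xs≢z) (AllPairs-index-tail P (x< ∷ xs<) x∷xs≢z)
  where
  x∷xs≢z : All (_≢ z) (x ∷ xs)
  x∷xs≢z = (z≢x ∘ sym) ∷ All.map (index-<⇒≢ P) x<

map-index : ∀ (g : ℕ → ℕ) X → Unique X → map (g ∘ index X) X ≡ applyUpTo g (length X)
map-index g []      []         = refl
map-index g (x ∷ X) (x∉X ∷ uX) = cong₂ _∷_ (cong g (index-head x X)) (begin
  map (g ∘ index (x ∷ X)) X
    ≡⟨ map-cong-local (All.map (λ x≢y → cong g (index-tail X (x≢y ∘ sym))) x∉X) ⟩
  map (g ∘ suc ∘ index X) X
    ≡⟨ map-index (g ∘ suc) X uX ⟩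
  applyUpTo (g ∘ suc) (length X)
    ∎)
  where open ≡-Reasoning

-- Erdős–Szekeres

MonotoneSublist : (A → A → Set) → ℕ → List A → Set
MonotoneSublist {A} R n xs = Σ[ ys ∈ List A ] ys ⊆ xs × length ys ≡ n × AllPairs R ys

MonotoneSublist-⊆ : ∀ {R : A → A → Set} {n} → xs ⊆ ys → MonotoneSublist R n xs → MonotoneSublist R n ys
MonotoneSublist-⊆ xs⊆ys (zs , zs⊆xs , |zs| , mono) = zs , ⊆-trans zs⊆xs xs⊆ys , |zs| , mono

MonotoneSublist-∷ : ∀ {R : A → A → Set} {n} → All (R x) xs → MonotoneSublist R n xs →
                    MonotoneSublist R (suc n) (x ∷ xs)
MonotoneSublist-∷ Rx (zs , zs⊆xs , |zs| , mono) =
  _ ∷ zs , refl ∷ zs⊆xs , cong suc |zs| , All-resp-⊆ zs⊆xs Rx ∷ mono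

module ErdősSzekeres {A : Set} (key : A → ℕ) where

  above below : A → List A → List A
  above x = filter (λ y → key x <? key y)
  below x = filter (λ y → key y <? key x)

  length-above+below : ∀ x xs → All (λ y → key x ≢ key y) xs →
                       length (above x xs) + length (below x xs) ≡ length xs
  length-above+below x []       []          = refl
  length-above+below x (y ∷ xs) (x≢y ∷ xs≢) with key x <? key y | key y <? key x
  ... | yes x<y | yes y<x = ⊥-elim (<-asym x<y y<x)
  ... | yes x<y | no y≮x
    rewrite filter-accept (λ y → key x <? key y) {xs = xs} x<y
          | filter-reject (λ y → key y <? key x) {xs = xs} y≮x
    = cong suc (length-above+below x xs xs≢)
  ... | no x≮y  | yes y<x
    rewrite filter-reject (λ y → key x <? key y) {xs = xs} x≮y
          | filter-accept (λ y → key y <? key x) {xs = xs} y<x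
    = trans (+-suc _ _) (cong suc (length-above+below x xs xs≢))
  ... | no x≮y  | no y≮x  = ⊥-elim (x≢y (≤-antisym (≮⇒≥ y≮x) (≮⇒≥ x≮y)))

  erdős-szekeres : ∀ a b xs → AllPairs (λ x y → key x ≢ key y) xs → 2 ^ (a + b) ≤ length xs →
                   MonotoneSublist (_<_ on key) a xs ⊎ MonotoneSublist (_>_ on key) b xs
  erdős-szekeres zero    b       xs _ _   = inj₁ ([] , minimum xs , refl , [])
  erdős-szekeres (suc a) zero    xs _ _   = inj₂ ([] , minimum xs , refl , [])
  erdős-szekeres (suc a) (suc b) [] _ big = ⊥-elim (n≮0 (<-≤-trans (m^n>0 2 (suc a + suc b)) big))
  erdős-szekeres (suc a) (suc b) (x ∷ xs) (x≢ ∷ distinct) big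
    with 2 ^ (a + suc b) ≤? length (above x xs)
  ... | yes big↑ with erdős-szekeres a (suc b) (above x xs) (AllPairs-resp-⊇ (filter-⊆ _ xs) distinct) big↑
  ...   | inj₁ inc = inj₁ (MonotoneSublist-⊆ (refl ∷ filter-⊆ _ xs) (MonotoneSublist-∷ (All.all-filter _ xs) inc))
  ...   | inj₂ dec = inj₂ (MonotoneSublist-⊆ (x ∷ʳ filter-⊆ _ xs) dec)
  erdős-szekeres (suc a) (suc b) (x ∷ xs) (x≢ ∷ distinct) big
      | no small↑ with erdős-szekeres (suc a) b (below x xs) (AllPairs-resp-⊇ (filter-⊆ _ xs) distinct) big↓
    where
    K : ℕ
    K = 2 ^ (a + suc b)
    big↓ : 2 ^ (suc a + b) ≤ length (below x xs)
    big↓ = subst (λ e → 2 ^ e ≤ length (below x xs)) (+-suc a b) (+-cancelˡ-≤ K _ _ (begin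
      K + K                                             ≡⟨ cong (K +_) (sym (+-identityʳ K)) ⟩
      2 ^ (suc a + suc b)                               ≤⟨ big ⟩
      suc (length xs)                                   ≡⟨ cong suc (length-above+below x xs x≢) ⟨
      suc (length (above x xs)) + length (below x xs)   ≤⟨ +-monoˡ-≤ _ (≰⇒> small↑) ⟩
      K + length (below x xs)                           ∎))
      where open ≤-Reasoning
  ...   | inj₁ inc = inj₁ (MonotoneSublist-⊆ (x ∷ʳ filter-⊆ _ xs) inc)
  ...   | inj₂ dec = inj₂ (MonotoneSublist-⊆ (refl ∷ filter-⊆ _ xs) (MonotoneSublist-∷ (All.all-filter _ xs) dec))

Aligned : List ℕ → List ℕ → Set
Aligned S P = S ⊆ P ⊎ reverse S ⊆ P

Aligned-resp-⊇ : ∀ {S T P} → S ⊆ T → Aligned T P → Aligned S P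
Aligned-resp-⊇ S⊆T (inj₁ T⊆P)  = inj₁ (⊆-trans S⊆T T⊆P)
Aligned-resp-⊇ S⊆T (inj₂ Tʳ⊆P) = inj₂ (⊆-trans (Sublist.reverse⁺ S⊆T) Tʳ⊆P)

∈-Aligned : ∀ {S P x} → Aligned S P → x ∈ S → x ∈ P
∈-Aligned (inj₁ S⊆P)  x∈S = Any-resp-⊆ S⊆P x∈S
∈-Aligned (inj₂ Sʳ⊆P) x∈S = Any-resp-⊆ Sʳ⊆P (Any.reverse⁺ x∈S)

aligned-sublist : ∀ t P X → Unique X → All (_∈ P) X → 2 ^ (t + t) ≤ length X →
                  Σ[ Y ∈ List ℕ ] Y ⊆ X × length Y ≡ t × Aligned Y P
aligned-sublist t P X uX X∈P big
  with ErdősSzekeres.erdős-szekeres (index P) t t X distinct big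
  where
  distinct : AllPairs (λ x y → index P x ≢ index P y) X
  distinct = AllPairs-map-All (λ x∈P y∈P x≢y → x≢y ∘ index-injective x∈P y∈P) X∈P uX
... | inj₁ (Y , Y⊆X , |Y| , inc) =
  Y , Y⊆X , |Y| , inj₁ (⊆-of-index-increasing P (All-resp-⊆ Y⊆X X∈P) inc)
... | inj₂ (Y , Y⊆X , |Y| , dec) =
  Y , Y⊆X , |Y| , inj₂ (⊆-of-index-increasing P (All-reverse⁺ (All-resp-⊆ Y⊆X X∈P)) (AllPairs-reverse⁺ dec))

tower : ℕ → ℕ → ℕ
tower n zero    = n
tower n (suc k) = 2 ^ (tower n k + tower n k)

aligned-to-all : ∀ n Ps X → Unique X → All (λ P → All (_∈ P) X) Ps → tower n (length Ps) ≤ length X →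
                 Σ[ S ∈ List ℕ ] S ⊆ X × length S ≡ n × All (Aligned S) Ps
aligned-to-all n [] X uX [] big = take n X , take-⊆ n X , trans (length-take n X) (m≤n⇒m⊓n≡m big) , []
aligned-to-all n (P ∷ Ps) X uX (X∈P ∷ X∈Ps) big
  with Y , Y⊆X , |Y| , Y~P ← aligned-sublist (tower n (length Ps)) P X uX X∈P big
  with S , S⊆Y , |S| , S~Ps ←
         aligned-to-all n Ps Y (AllPairs-resp-⊇ Y⊆X uX) (All.map (All-resp-⊆ Y⊆X) X∈Ps) (≤-reflexive (sym |Y|)) =
  S , ⊆-trans S⊆Y Y⊆X , |S| , Aligned-resp-⊇ S⊆Y Y~P ∷ S~Ps

-- Occurrences of I_c D_c I_c

IDI : List ℕ → List ℕ
IDI X = X ++ reverse X ++ X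

∈-IDI : ∀ {X x} → x ∈ IDI X → x ∈ X
∈-IDI {X} x∈ with Any.++⁻ X x∈
... | inj₁ x∈X = x∈X
... | inj₂ x∈XʳX with Any.++⁻ (reverse X) x∈XʳX
...   | inj₁ x∈Xʳ = Any.reverse⁻ x∈Xʳ
...   | inj₂ x∈X  = x∈X

contains-IDI : ∀ c X {w} → Unique X → length X ≡ c → IDI X ⊆ w → Contains w (I c ++ D c ++ I c)
contains-IDI c X uX |X| IDI⊆w = IDI X , IDI⊆w , rename , injective , renamed
  where
  open ≡-Reasoning
  rename : ℕ → ℕ
  rename = suc ∘ index X
  injective : ∀ {x y} → x ∈ IDI X → y ∈ IDI X → rename x ≡ rename y → x ≡ y
  injective x∈ y∈ eq = index-injective (∈-IDI {X} x∈) (∈-IDI {X} y∈) (suc-injective eq)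
  X↦I : map rename X ≡ I c
  X↦I = trans (map-index suc X uX) (cong (applyUpTo suc) |X|)
  renamed : map rename (IDI X) ≡ I c ++ D c ++ I c
  renamed = begin
    map rename (X ++ reverse X ++ X)                        ≡⟨ map-++ rename X _ ⟩
    map rename X ++ map rename (reverse X ++ X)             ≡⟨ cong (map rename X ++_) (map-++ rename (reverse X) X) ⟩
    map rename X ++ map rename (reverse X) ++ map rename X  ≡⟨ cong (λ w → map rename X ++ w ++ map rename X)
                                                                    (reverse-map rename X) ⟩
    map rename X ++ reverse (map rename X) ++ map rename X  ≡⟨ cong (λ w → w ++ reverse w ++ w) X↦I ⟩
    I c ++ D c ++ I c                                       ∎

IDI-of-contains : ∀ c {w} → Contains w (I c ++ D c ++ I c) → Σ[ X ∈ List ℕ ] length X ≡ c × IDI X ⊆ w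
IDI-of-contains c (t , t⊆w , f , inj , t↦)
  with t₁ , t₂₃ , refl , t₁↦ , t₂₃↦ ← map-++⁻ f t {I c} t↦
  with t₂ , t₃ , refl , t₂↦ , t₃↦ ← map-++⁻ f t₂₃ {D c} t₂₃↦ =
  t₁ , |t₁| , subst (_⊆ _) (cong₂ (λ u v → t₁ ++ u ++ v) t₂≡ t₃≡) t⊆w
  where
  ∈t₁ : All (_∈ t₁ ++ t₂ ++ t₃) t₁
  ∈t₁ = All.tabulate Any.++⁺ˡ
  ∈t₂ : All (_∈ t₁ ++ t₂ ++ t₃) t₂
  ∈t₂ = All.tabulate (Any.++⁺ʳ t₁ ∘ Any.++⁺ˡ)
  ∈t₃ : All (_∈ t₁ ++ t₂ ++ t₃) t₃
  ∈t₃ = All.tabulate (Any.++⁺ʳ t₁ ∘ Any.++⁺ʳ t₂)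
  t₃≡ : t₃ ≡ t₁
  t₃≡ = map-injective-on f inj ∈t₃ ∈t₁ (trans t₃↦ (sym t₁↦))
  t₂≡ : t₂ ≡ reverse t₁
  t₂≡ = map-injective-on f inj ∈t₂ (All-reverse⁺ ∈t₁)
          (trans t₂↦ (trans (cong reverse (sym t₁↦)) (sym (reverse-map f t₁))))
  |t₁| : length t₁ ≡ c
  |t₁| = trans (sym (length-map f t₁)) (trans (cong length t₁↦) (length-applyUpTo suc c))

-- The upper bound

-- one letter of xs in each of the first blocks, then ys inside the next one
spread-++ : ∀ {S} xs {ys} Bs → All (_∈ S) xs → length xs < length Bs → All (Aligned S) Bs → All (ys ⊆_) Bs →
            xs ++ ys ⊆ concat Bs
spread-++ []       (B ∷ Bs) _            _           _            (ys⊆B ∷ _)  = ++⁺ʳ (concat Bs) ys⊆B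
spread-++ (x ∷ xs) (B ∷ Bs) (x∈S ∷ xs∈S) (s≤s |xs|<) (S~B ∷ S~Bs) (_ ∷ ys⊆Bs) =
  ++⁺ (from∈ (∈-Aligned S~B x∈S)) (spread-++ xs Bs xs∈S |xs|< S~Bs ys⊆Bs)

forward-then-backward : ∀ {S} Ps → All (Aligned S) Ps →
  reverse S ++ S ⊆ concat Ps ⊎
  Σ[ As ∈ List (List ℕ) ] Σ[ Bs ∈ List (List ℕ) ] Ps ≡ As ++ Bs × All (S ⊆_) As × All (reverse S ⊆_) Bs
forward-then-backward []       []           = inj₂ ([] , [] , refl , [] , [])
forward-then-backward (P ∷ Ps) (S~P ∷ S~Ps) with forward-then-backward Ps S~Ps
... | inj₁ Sʳ++S⊆Ps = inj₁ (++⁺ˡ P Sʳ++S⊆Ps)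
... | inj₂ (As , Bs , refl , fwd , bwd) with S~P | As | fwd
...   | inj₁ S⊆P  | As′   | fwd′    = inj₂ (P ∷ As′ , Bs , refl , S⊆P ∷ fwd′ , bwd)
...   | inj₂ Sʳ⊆P | []    | []      = inj₂ ([] , P ∷ Bs , refl , [] , Sʳ⊆P ∷ bwd)
...   | inj₂ Sʳ⊆P | A ∷ _ | S⊆A ∷ _ = inj₁ (++⁺ Sʳ⊆P (++⁺ʳ _ S⊆A))

IDI-backward : ∀ S {P} B₁ Bs → length S < length Bs → S ⊆ P → All (reverse S ⊆_) (B₁ ∷ Bs) →
               IDI S ⊆ P ++ concat (B₁ ∷ Bs)
IDI-backward S B₁ Bs |S|< S⊆P (Sʳ⊆B₁ ∷ bwd) =
  ++⁺ S⊆P (++⁺ Sʳ⊆B₁ (subst (_⊆ concat Bs) (++-identityʳ S)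
    (spread-++ S Bs (all-∈ S) |S|< (All.map inj₂ bwd) (All.map (λ {B} _ → minimum B) bwd))))

IDI-forward : ∀ S {P} As Bs → length S < length As → S ⊆ P → All (S ⊆_) As → IDI S ⊆ P ++ concat (As ++ Bs)
IDI-forward S As Bs |S|< S⊆P fwd =
  ++⁺ S⊆P (subst (_⊆ concat (As ++ Bs)) (++-identityʳ (reverse S ++ S)) (concat-++⁺ As Bs
    (spread-++ (reverse S) As (All-reverse⁺ (all-∈ S)) (subst (_< length As) (sym (length-reverse S)) |S|<)
               (All.map inj₁ fwd) fwd)
    (minimum (concat Bs))))

-- IDI X is cut as (reverse Q ++ [ z ]) (R ++ reverse (z ∷ R)) (Q ++ reverse Q ++ z ∷ R). The first piece
-- lies in S; in the second, the letters of R go into separate forward blocks and the suffix reverse (z ∷ R)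
-- of S into the next one; in the third, Q lies in reverse S in the first backward block, the letters of
-- reverse Q go into separate further backward blocks and the prefix z ∷ R of reverse S into the next one.
IDI-mixed : ∀ S z R Q {P} As B₁ Bs → reverse S ≡ z ∷ R ++ Q → length R < length As → length Q < length Bs →
            S ⊆ P → All (S ⊆_) As → All (reverse S ⊆_) (B₁ ∷ Bs) →
            IDI (reverse Q ++ z ∷ R) ⊆ P ++ concat (As ++ B₁ ∷ Bs)
IDI-mixed S z R Q As B₁ Bs Sʳ≡ |R|< |Q|< S⊆P fwd (Sʳ⊆B₁ ∷ bwd) =
  subst (_⊆ _) (sym IDI-X≡) (++⁺ (⊆-trans Qʳz⊆S S⊆P) (concat-++⁺ As (B₁ ∷ Bs)
    (spread-++ R As (All.tabulate R⊆S) |R|< (All.map inj₁ fwd) (All.map (⊆-trans Rʳz⊆S) fwd))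
    (++⁺ (⊆-trans Q⊆Sʳ Sʳ⊆B₁)
         (spread-++ (reverse Q) Bs (All.tabulate (Q⊆S ∘ Any.reverse⁻))
                    (subst (_< length Bs) (sym (length-reverse Q)) |Q|<)
                    (All.map inj₂ bwd) (All.map (⊆-trans zR⊆Sʳ) bwd)))))
  where
  open ≡-Reasoning
  X Rʳz : List ℕ
  X   = reverse Q ++ z ∷ R
  Rʳz = reverse (z ∷ R)
  S≡ : S ≡ reverse Q ++ Rʳz
  S≡ = begin
    S                       ≡⟨ reverse-involutive S ⟨
    reverse (reverse S)     ≡⟨ cong reverse Sʳ≡ ⟩
    reverse ((z ∷ R) ++ Q)  ≡⟨ reverse-++ (z ∷ R) Q ⟩
    reverse Q ++ Rʳz        ∎
  IDI-X≡ : IDI X ≡ (reverse Q ++ [ z ]) ++ (R ++ Rʳz) ++ (Q ++ X)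
  IDI-X≡ = begin
    X ++ reverse X ++ X                            ≡⟨ cong (λ w → X ++ w ++ X) Xʳ≡ ⟩
    (reverse Q ++ z ∷ R) ++ (Rʳz ++ Q) ++ X        ≡⟨ ++-assoc (reverse Q) (z ∷ R) _ ⟩
    reverse Q ++ z ∷ R ++ (Rʳz ++ Q) ++ X          ≡⟨ cong (λ w → reverse Q ++ z ∷ w) regroup ⟩
    reverse Q ++ z ∷ (R ++ Rʳz) ++ (Q ++ X)        ≡⟨ ++-assoc (reverse Q) [ z ] _ ⟨
    (reverse Q ++ [ z ]) ++ (R ++ Rʳz) ++ (Q ++ X) ∎
    where
    Xʳ≡ : reverse X ≡ Rʳz ++ Q
    Xʳ≡ = trans (reverse-++ (reverse Q) (z ∷ R)) (cong (Rʳz ++_) (reverse-involutive Q))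
    regroup : R ++ (Rʳz ++ Q) ++ X ≡ (R ++ Rʳz) ++ (Q ++ X)
    regroup = trans (cong (R ++_) (++-assoc Rʳz Q X)) (sym (++-assoc R Rʳz (Q ++ X)))
  Qʳz⊆S : reverse Q ++ [ z ] ⊆ S
  Qʳz⊆S = subst (_ ⊆_) (sym S≡) (++⁺ ⊆-refl (from∈ (Any.reverse⁺ {xs = z ∷ R} (here refl))))
  Rʳz⊆S : Rʳz ⊆ S
  Rʳz⊆S = subst (_ ⊆_) (sym S≡) (++⁺ˡ (reverse Q) (⊆-refl {x = Rʳz}))
  Q⊆Sʳ : Q ⊆ reverse S
  Q⊆Sʳ = subst (_ ⊆_) (sym Sʳ≡) (++⁺ˡ (z ∷ R) ⊆-refl)
  zR⊆Sʳ : z ∷ R ⊆ reverse S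
  zR⊆Sʳ = subst (_ ⊆_) (sym Sʳ≡) (++⁺ʳ Q ⊆-refl)
  R⊆S : ∀ {x} → x ∈ R → x ∈ S
  R⊆S x∈R = Any.reverse⁻ (Any-resp-⊆ zR⊆Sʳ (there x∈R))
  Q⊆S : ∀ {x} → x ∈ Q → x ∈ S
  Q⊆S x∈Q = Any.reverse⁻ (Any-resp-⊆ Q⊆Sʳ x∈Q)

reverse-split-↭ : ∀ {S R Q : List A} {z} → reverse S ≡ z ∷ R ++ Q → reverse Q ++ z ∷ R ↭ S
reverse-split-↭ {S = S} {R} {Q} {z} Sʳ≡ =
  ↭-trans (Permutation.++⁺ʳ (z ∷ R) (↭-reverse Q))
    (↭-trans (Permutation.++-comm Q (z ∷ R)) (subst (_↭ S) Sʳ≡ (↭-reverse S)))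

IDI-in-aligned-blocks : ∀ S P Ps → length Ps ≡ 2 + length S → S ⊆ P → All (Aligned S) Ps →
                        Σ[ X ∈ List ℕ ] X ↭ S × IDI X ⊆ P ++ concat Ps
IDI-in-aligned-blocks S P Ps |Ps| S⊆P S~Ps with forward-then-backward Ps S~Ps
... | inj₁ Sʳ++S⊆Ps                    = S , ↭-refl , ++⁺ S⊆P Sʳ++S⊆Ps
... | inj₂ (As , Bs , refl , fwd , bwd) = blocks As Bs (trans (sym (length-++ As)) |Ps|) fwd bwd
  where
  mixed : ∀ A₁ As B₁ B₂ Bs → length S ≡ suc (length As + length Bs) →
          All (S ⊆_) (A₁ ∷ As) → All (reverse S ⊆_) (B₁ ∷ B₂ ∷ Bs) →
          Σ[ X ∈ List ℕ ] X ↭ S × IDI X ⊆ P ++ concat ((A₁ ∷ As) ++ B₁ ∷ B₂ ∷ Bs)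
  mixed A₁ As B₁ B₂ Bs |S|≡ fwd bwd
    with z , T , Sʳ≡ , |T| ← ∷-of-length-suc (reverse S) (trans (length-reverse S) |S|≡)
    with R , Q , refl , |R|≤ , |Q|≤ ← split-≤-+ (length As) T (≤-reflexive |T|) =
    reverse Q ++ z ∷ R , reverse-split-↭ Sʳ≡ ,
    IDI-mixed S z R Q (A₁ ∷ As) B₁ (B₂ ∷ Bs) Sʳ≡ (s≤s |R|≤) (s≤s |Q|≤) S⊆P fwd bwd

  blocks : ∀ As Bs → length As + length Bs ≡ 2 + length S → All (S ⊆_) As → All (reverse S ⊆_) Bs →
           Σ[ X ∈ List ℕ ] X ↭ S × IDI X ⊆ P ++ concat (As ++ Bs)
  blocks []        []                ()      _   _
  blocks []        (B₁ ∷ Bs)         |Bs|    []  bwd =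
    S , ↭-refl , IDI-backward S B₁ Bs (≤-reflexive (sym (suc-injective |Bs|))) S⊆P bwd
  blocks As        []                |As|    fwd _   =
    S , ↭-refl , IDI-forward S As [] (m+n≡2+o⇒o<m |As| z≤n) S⊆P fwd
  blocks As        (B₁ ∷ [])         |As|    fwd _   =
    S , ↭-refl , IDI-forward S As _ (m+n≡2+o⇒o<m |As| (s≤s z≤n)) S⊆P fwd
  blocks (A₁ ∷ As) (B₁ ∷ B₂ ∷ Bs)    |AsBs|  fwd bwd = mixed A₁ As B₁ B₂ Bs |S|≡ fwd bwd
    where
    open ≡-Reasoning
    |S|≡ : length S ≡ suc (length As + length Bs)
    |S|≡ = suc-injective (begin
      suc (length S)                     ≡⟨ suc-injective |AsBs| ⟨
      length As + suc (suc (length Bs))  ≡⟨ +-suc (length As) _ ⟩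
      suc (length As + suc (length Bs))  ≡⟨ cong suc (+-suc (length As) _) ⟩
      suc (suc (length As + length Bs))  ∎)

IDI-forced : ∀ c → Forces (I c ++ D c ++ I c) (c + 3)
IDI-forced c = tower c (2 + c) , forced
  where
  forced : ∀ w → IsFormation (tower c (2 + c)) (c + 3) w → Contains w (I c ++ D c ++ I c)
  forced _ (_ , _ , _ , [] , |ps| , _ , _) = ⊥-elim (0≢1+n (trans |ps| (+-comm c 3)))
  forced w (L , uL , |L| , P₁ ∷ Ps , |ps| , P₁↭L ∷ Ps↭L , refl) =
    let S , S⊆P₁ , |S| , S~Ps = aligned-to-all c Ps P₁ uP₁ P₁∈Ps (≤-reflexive (sym |P₁|))
        X , X↭S , IDI⊆       = IDI-in-aligned-blocks S P₁ Ps (trans |Ps| (cong (2 +_) (sym |S|))) S⊆P₁ S~Ps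
    in contains-IDI c X (Unique-resp-↭ (↭-sym X↭S) (AllPairs-resp-⊇ S⊆P₁ uP₁))
                    (trans (↭-length X↭S) |S|) IDI⊆
    where
    uP₁ : Unique P₁
    uP₁ = Unique-resp-↭ (↭-sym P₁↭L) uL
    |Ps| : length Ps ≡ 2 + c
    |Ps| = suc-injective (trans |ps| (+-comm c 3))
    |P₁| : length P₁ ≡ tower c (length Ps)
    |P₁| = trans (↭-length P₁↭L) (trans |L| (cong (tower c) (sym |Ps|)))
    P₁∈Ps : All (λ P → All (_∈ P) P₁) Ps
    P₁∈Ps = All.map (λ P↭L → All.tabulate (∈-resp-↭ (↭-trans P₁↭L (↭-sym P↭L)))) Ps↭L

-- Counting adjacent pairs

indicator : ∀ {P : Set} → Dec P → ℕ
indicator (yes _) = 1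
indicator (no _)  = 0

indicator≤1 : ∀ {P : Set} (p? : Dec P) → indicator p? ≤ 1
indicator≤1 (yes _) = ≤-refl
indicator≤1 (no _)  = z≤n

module _ {R : A → A → Set} (R? : Decidable R) where

  countFrom : A → List A → ℕ
  countFrom x []       = 0
  countFrom x (y ∷ ys) = indicator (R? x y) + countFrom y ys

  countAdjacent : List A → ℕ
  countAdjacent []       = 0
  countAdjacent (x ∷ xs) = countFrom x xs

  countFrom-++ : ∀ w xs x y ys → countFrom w ((xs ++ [ x ]) ++ y ∷ ys) ≡
                 countFrom w (xs ++ [ x ]) + (indicator (R? x y) + countFrom y ys)
  countFrom-++ w []       x y ys = cong (_+ (indicator (R? x y) + countFrom y ys)) (sym (+-identityʳ (indicator (R? w x))))
  countFrom-++ w (v ∷ xs) x y ys =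
    trans (cong (indicator (R? w v) +_) (countFrom-++ v xs x y ys)) (sym (+-assoc (indicator (R? w v)) _ _))

  countAdjacent-++ : ∀ xs x y ys → countAdjacent ((xs ++ [ x ]) ++ y ∷ ys) ≡
                     countAdjacent (xs ++ [ x ]) + (indicator (R? x y) + countAdjacent (y ∷ ys))
  countAdjacent-++ []       x y ys = refl
  countAdjacent-++ (w ∷ xs) x y ys = countFrom-++ w xs x y ys

  countAdjacent-++-≥ : ∀ xs ys → countAdjacent xs + countAdjacent ys ≤ countAdjacent (xs ++ ys)
  countAdjacent-++-≥ xs ys with reverseView xs | ys
  ... | []           | _       = ≤-refl
  ... | xs′ ∶ _ ∶ʳ x | []      =
    ≤-reflexive (trans (+-identityʳ _) (cong countAdjacent (sym (++-identityʳ (xs′ ++ [ x ])))))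
  ... | xs′ ∶ _ ∶ʳ x | y ∷ ys′ = begin
    countAdjacent (xs′ ++ [ x ]) + countAdjacent (y ∷ ys′)
      ≤⟨ +-monoʳ-≤ (countAdjacent (xs′ ++ [ x ])) (m≤n+m _ (indicator (R? x y))) ⟩
    countAdjacent (xs′ ++ [ x ]) + (indicator (R? x y) + countAdjacent (y ∷ ys′))
      ≡⟨ countAdjacent-++ xs′ x y ys′ ⟨
    countAdjacent ((xs′ ++ [ x ]) ++ y ∷ ys′)
      ∎
    where open ≤-Reasoning

  countAdjacent-++-≤ : ∀ xs ys → countAdjacent (xs ++ ys) ≤ suc (countAdjacent xs + countAdjacent ys)
  countAdjacent-++-≤ xs ys with reverseView xs | ys
  ... | []           | _       = n≤1+n _
  ... | xs′ ∶ _ ∶ʳ x | []      =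
    ≤-trans (≤-reflexive (trans (cong countAdjacent (++-identityʳ (xs′ ++ [ x ]))) (sym (+-identityʳ _)))) (n≤1+n _)
  ... | xs′ ∶ _ ∶ʳ x | y ∷ ys′ = begin
    countAdjacent ((xs′ ++ [ x ]) ++ y ∷ ys′)
      ≡⟨ countAdjacent-++ xs′ x y ys′ ⟩
    countAdjacent (xs′ ++ [ x ]) + (indicator (R? x y) + countAdjacent (y ∷ ys′))
      ≤⟨ +-monoʳ-≤ _ (+-monoˡ-≤ _ (indicator≤1 (R? x y))) ⟩
    countAdjacent (xs′ ++ [ x ]) + suc (countAdjacent (y ∷ ys′))
      ≡⟨ +-suc _ _ ⟩
    suc (countAdjacent (xs′ ++ [ x ]) + countAdjacent (y ∷ ys′))
      ∎
    where open ≤-Reasoning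

  countAdjacent-repeat : R z z → ∀ xs ys → countAdjacent ((xs ++ [ z ]) ++ z ∷ ys) ≡
                         countAdjacent (xs ++ [ z ]) + suc (countAdjacent (z ∷ ys))
  countAdjacent-repeat {z} Rzz xs ys with R? z z | countAdjacent-++ xs z z ys
  ... | yes _   | eq = eq
  ... | no ¬Rzz | _  = ⊥-elim (¬Rzz Rzz)

  countAdjacent-none : AllPairs (λ x y → ¬ R x y) xs → countAdjacent xs ≡ 0
  countAdjacent-none []                              = refl
  countAdjacent-none (_ ∷ [])                        = refl
  countAdjacent-none {x ∷ y ∷ _} ((¬Rxy ∷ _) ∷ rest) with R? x y
  ... | yes Rxy = ⊥-elim (¬Rxy Rxy)
  ... | no _    = countAdjacent-none rest

  -- no pair inside a block, at most one across each boundary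
  countAdjacent-blocks : ∀ Bs {q} → All (AllPairs (λ x y → ¬ R x y)) Bs → q ⊆ concat Bs →
                         countAdjacent q ≤ pred (length Bs)
  countAdjacent-blocks []       []  []  = z≤n
  countAdjacent-blocks (B ∷ []) (noB ∷ []) q⊆ =
    ≤-reflexive (countAdjacent-none (AllPairs-resp-⊇ (subst (_ ⊆_) (++-identityʳ B) q⊆) noB))
  countAdjacent-blocks (B ∷ Bs@(_ ∷ _)) (noB ∷ noBs) q⊆
    with q₁ , q₂ , refl , q₁⊆ , q₂⊆ ← ⊆-++⁻ B (concat Bs) q⊆ = begin
    countAdjacent (q₁ ++ q₂)                   ≤⟨ countAdjacent-++-≤ q₁ q₂ ⟩
    suc (countAdjacent q₁ + countAdjacent q₂)  ≡⟨ cong (λ k → suc (k + countAdjacent q₂))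
                                                        (countAdjacent-none (AllPairs-resp-⊇ q₁⊆ noB)) ⟩
    suc (countAdjacent q₂)                     ≤⟨ s≤s (countAdjacent-blocks Bs noBs q₂⊆) ⟩
    suc (pred (length Bs))                     ∎
    where open ≤-Reasoning

countAdjacent-reverse : ∀ {R : A → A → Set} (R? : Decidable R) xs →
                        countAdjacent (flip R?) (reverse xs) ≡ countAdjacent R? xs
countAdjacent-reverse R? []           = refl
countAdjacent-reverse R? (x ∷ [])     = refl
countAdjacent-reverse R? (x ∷ y ∷ xs) = begin
  countAdjacent (flip R?) (reverse (x ∷ y ∷ xs))
    ≡⟨ cong (countAdjacent (flip R?)) xyxsʳ≡ ⟩
  countAdjacent (flip R?) ((reverse xs ++ [ y ]) ++ [ x ])
    ≡⟨ countAdjacent-++ (flip R?) (reverse xs) y x [] ⟩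
  countAdjacent (flip R?) (reverse xs ++ [ y ]) + (indicator (R? x y) + 0)
    ≡⟨ cong (λ w → countAdjacent (flip R?) w + (indicator (R? x y) + 0)) (unfold-reverse y xs) ⟨
  countAdjacent (flip R?) (reverse (y ∷ xs)) + (indicator (R? x y) + 0)
    ≡⟨ cong₂ _+_ (countAdjacent-reverse R? (y ∷ xs)) (+-identityʳ _) ⟩
  countAdjacent R? (y ∷ xs) + indicator (R? x y)
    ≡⟨ +-comm _ (indicator (R? x y)) ⟩
  countAdjacent R? (x ∷ y ∷ xs)
    ∎
  where
  open ≡-Reasoning
  xyxsʳ≡ : reverse (x ∷ y ∷ xs) ≡ (reverse xs ++ [ y ]) ++ [ x ]
  xyxsʳ≡ = trans (unfold-reverse x (y ∷ xs)) (cong (_++ [ x ]) (unfold-reverse y xs))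

-- the junction of xs and its mirror image is a repeated letter
countAdjacent-mirror : ∀ {R : A → A → Set} (R? : Decidable R) → Reflexive R → ∀ xs → xs ≢ [] →
  countAdjacent R? (xs ++ reverse xs) ≡ countAdjacent R? xs + suc (countAdjacent (flip R?) xs)
countAdjacent-mirror R? refl-R xs xs≢[] with reverseView xs
... | []          = ⊥-elim (xs≢[] refl)
... | ys ∶ _ ∶ʳ z = begin
  countAdjacent R? (X ++ reverse X)                             ≡⟨ cong (countAdjacent R? ∘ (X ++_)) Xʳ≡ ⟩
  countAdjacent R? (X ++ z ∷ reverse ys)                        ≡⟨ countAdjacent-repeat R? refl-R ys (reverse ys) ⟩
  countAdjacent R? X + suc (countAdjacent R? (z ∷ reverse ys))  ≡⟨ cong (plus-suc ∘ countAdjacent R?) Xʳ≡ ⟨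
  countAdjacent R? X + suc (countAdjacent R? (reverse X))       ≡⟨ cong plus-suc (countAdjacent-reverse (flip R?) X) ⟩
  countAdjacent R? X + suc (countAdjacent (flip R?) X)          ∎
  where
  open ≡-Reasoning
  X : List _
  X = ys ++ [ z ]
  Xʳ≡ : reverse X ≡ z ∷ reverse ys
  Xʳ≡ = reverse-++ ys [ z ]
  plus-suc : ℕ → ℕ
  plus-suc k = countAdjacent R? X + suc k

-- a nonempty prefix of reverse xs starts with the last letter of xs
countAdjacent-repeat-last : ∀ {R : A → A → Set} (R? : Decidable R) → Reflexive R → ∀ xs {y₁ y₂} →
  reverse xs ≡ y₁ ++ y₂ → y₁ ≢ [] → countAdjacent R? xs < countAdjacent R? (xs ++ y₁)
countAdjacent-repeat-last R? refl-R xs {y₁} xsʳ≡ y₁≢[] with reverseView xs | y₁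
... | []          | []      = ⊥-elim (y₁≢[] refl)
... | []          | _ ∷ _   = ⊥-elim (0≢1+n (cong length xsʳ≡))
... | _ ∶ _ ∶ʳ _  | []      = ⊥-elim (y₁≢[] refl)
... | ys ∶ _ ∶ʳ z | _ ∷ y₁′ with refl ← ∷-injectiveˡ (trans (sym (reverse-++ ys [ z ])) xsʳ≡) =
  subst (countAdjacent R? (ys ++ [ z ]) <_) (sym (countAdjacent-repeat R? refl-R ys y₁′)) (m<m+n _ z<s)

nonAscents nonDescents : List ℕ → ℕ
nonAscents  = countAdjacent (flip _≤?_)
nonDescents = countAdjacent _≤?_

length≤1+nonAscents+nonDescents : ∀ xs → length xs ≤ suc (nonAscents xs + nonDescents xs)
length≤1+nonAscents+nonDescents []       = z≤n
length≤1+nonAscents+nonDescents (x ∷ xs) = s≤s (from x xs)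
  where
  one≤ : ∀ x y → 1 ≤ indicator (y ≤? x) + indicator (x ≤? y)
  one≤ x y with y ≤? x | x ≤? y
  ... | yes _  | _      = s≤s z≤n
  ... | no _   | yes _  = s≤s z≤n
  ... | no y≰x | no x≰y = ⊥-elim (x≰y (≰⇒≥ y≰x))
  from : ∀ x ys → length ys ≤ countFrom (flip _≤?_) x ys + countFrom _≤?_ x ys
  from x []       = z≤n
  from x (y ∷ ys) =
    ≤-trans (+-mono-≤ (one≤ x y) (from y ys))
            (≤-reflexive (interchange (indicator (y ≤? x)) (indicator (x ≤? y)) _ _))

nonAscents-mirror : ∀ X → X ≢ [] → nonAscents (X ++ reverse X) ≡ nonAscents X + suc (nonDescents X)
nonAscents-mirror = countAdjacent-mirror (flip _≤?_) ≤-refl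

nonDescents-mirror : ∀ X → X ≢ [] → nonDescents (reverse X ++ X) ≡ nonAscents X + suc (nonDescents X)
nonDescents-mirror X X≢[] = begin
  nonDescents (reverse X ++ X)
    ≡⟨ cong (nonDescents ∘ (reverse X ++_)) (reverse-involutive X) ⟨
  nonDescents (reverse X ++ reverse (reverse X))
    ≡⟨ countAdjacent-mirror _≤?_ ≤-refl (reverse X) Xʳ≢[] ⟩
  nonDescents (reverse X) + suc (nonAscents (reverse X))
    ≡⟨ cong₂ (λ a d → a + suc d) (countAdjacent-reverse (flip _≤?_) X) (countAdjacent-reverse _≤?_ X) ⟩
  nonAscents X + suc (nonDescents X)
    ∎
  where
  open ≡-Reasoning
  Xʳ≢[] : reverse X ≢ []
  Xʳ≢[] Xʳ≡[] = X≢[] (trans (sym (reverse-involutive X)) (cong reverse Xʳ≡[]))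

nonDescents-repeat-first : ∀ X {y₁ y₂} → reverse X ≡ y₁ ++ y₂ → y₂ ≢ [] →
                           nonDescents X < nonDescents (y₂ ++ X)
nonDescents-repeat-first X {y₁} {y₂} Xʳ≡ y₂≢[] = begin-strict
  nonDescents X
    ≡⟨ countAdjacent-reverse _≤?_ X ⟨
  nonAscents (reverse X)
    <⟨ countAdjacent-repeat-last (flip _≤?_) ≤-refl (reverse X) Xʳʳ≡ y₂ʳ≢[] ⟩
  nonAscents (reverse X ++ reverse y₂)
    ≡⟨ cong nonAscents (reverse-++ y₂ X) ⟨
  nonAscents (reverse (y₂ ++ X))
    ≡⟨ countAdjacent-reverse _≤?_ (y₂ ++ X) ⟩
  nonDescents (y₂ ++ X)
    ∎
  where
  open ≤-Reasoning
  Xʳʳ≡ : reverse (reverse X) ≡ reverse y₂ ++ reverse y₁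
  Xʳʳ≡ = trans (cong reverse Xʳ≡) (reverse-++ y₁ y₂)
  y₂ʳ≢[] : reverse y₂ ≢ []
  y₂ʳ≢[] y₂ʳ≡[] = y₂≢[] (trans (sym (reverse-involutive y₂)) (cong reverse y₂ʳ≡[]))

-- The lower bound

IDI-cut : ∀ {c} X {p q} → 2 ≤ c → length X ≡ c → IDI X ≡ p ++ q →
          nonAscents p ≤ 1 → nonDescents q ≤ pred c → ⊥
IDI-cut {c@(suc (suc k))} X {p} {q} (s≤s (s≤s _)) |X| IDI≡ ascents-p descents-q =
  cut (++-split₃ X (reverse X) X IDI≡)
  where
  open ≤-Reasoning
  X≢[] : X ≢ []
  X≢[] refl = 0≢1+n |X|
  c≤ : c ≤ nonAscents X + suc (nonDescents X)
  c≤ = begin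
    c                                   ≡⟨ |X| ⟨
    length X                            ≤⟨ length≤1+nonAscents+nonDescents X ⟩
    suc (nonAscents X + nonDescents X)  ≡⟨ +-suc _ _ ⟨
    nonAscents X + suc (nonDescents X)  ∎
  many-ascents : nonAscents (X ++ reverse X) ≤ nonAscents p → ⊥
  many-ascents many = 1+n≰n (begin
    2                                   ≤⟨ s≤s (s≤s z≤n) ⟩
    c                                   ≤⟨ c≤ ⟩
    nonAscents X + suc (nonDescents X)  ≡⟨ nonAscents-mirror X X≢[] ⟨
    nonAscents (X ++ reverse X)         ≤⟨ many ⟩
    nonAscents p                        ≤⟨ ascents-p ⟩
    1                                   ∎)
  many-descents : nonDescents (reverse X ++ X) ≤ nonDescents q → ⊥
  many-descents many = 1+n≰n (begin
    c                                   ≤⟨ c≤ ⟩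
    nonAscents X + suc (nonDescents X)  ≡⟨ nonDescents-mirror X X≢[] ⟨
    nonDescents (reverse X ++ X)        ≤⟨ many ⟩
    nonDescents q                       ≤⟨ descents-q ⟩
    suc k                               ∎)
  cut : (Σ[ m ∈ List ℕ ] q ≡ m ++ reverse X ++ X)
      ⊎ (Σ[ y₁ ∈ List ℕ ] Σ[ y₂ ∈ List ℕ ] reverse X ≡ y₁ ++ y₂ × p ≡ X ++ y₁ × q ≡ y₂ ++ X)
      ⊎ (Σ[ m ∈ List ℕ ] p ≡ X ++ reverse X ++ m) → ⊥
  cut (inj₁ (m , q≡)) = many-descents (begin
    nonDescents (reverse X ++ X)                  ≤⟨ m≤n+m _ _ ⟩
    nonDescents m + nonDescents (reverse X ++ X)  ≤⟨ countAdjacent-++-≥ _≤?_ m (reverse X ++ X) ⟩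
    nonDescents (m ++ reverse X ++ X)             ≡⟨ cong nonDescents q≡ ⟨
    nonDescents q                                 ∎)
  cut (inj₂ (inj₂ (m , p≡))) = many-ascents (begin
    nonAscents (X ++ reverse X)                   ≤⟨ m≤m+n _ _ ⟩
    nonAscents (X ++ reverse X) + nonAscents m    ≤⟨ countAdjacent-++-≥ (flip _≤?_) (X ++ reverse X) m ⟩
    nonAscents ((X ++ reverse X) ++ m)            ≡⟨ cong nonAscents (trans (++-assoc X (reverse X) m) (sym p≡)) ⟩
    nonAscents p                                  ∎)
  cut (inj₂ (inj₁ ([] , y₂ , refl , p≡ , q≡))) = many-descents (≤-reflexive (cong nonDescents (sym q≡)))
  cut (inj₂ (inj₁ (y₁ , [] , Xʳ≡ , p≡ , q≡))) =
    many-ascents (≤-reflexive (cong nonAscents (trans (cong (X ++_) (trans Xʳ≡ (++-identityʳ y₁))) (sym p≡))))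
  cut (inj₂ (inj₁ (y₁@(_ ∷ _) , y₂@(_ ∷ _) , Xʳ≡ , p≡ , q≡))) = 1+n≰n (begin
    suc c                                         ≤⟨ s≤s c≤ ⟩
    suc (nonAscents X) + suc (nonDescents X)
      ≤⟨ +-mono-≤ (countAdjacent-repeat-last (flip _≤?_) ≤-refl X Xʳ≡ (λ ()))
                  (nonDescents-repeat-first X {y₁} Xʳ≡ (λ ())) ⟩
    nonAscents (X ++ y₁) + nonDescents (y₂ ++ X)
      ≡⟨ cong₂ (λ u v → nonAscents u + nonDescents v) p≡ q≡ ⟨
    nonAscents p + nonDescents q
      ≤⟨ +-mono-≤ ascents-p descents-q ⟩
    c ∎)

avoids-IDI : ∀ c L X → 2 ≤ c → AllPairs _<_ L → length X ≡ c →
             ¬ (IDI X ⊆ concat (L ∷ L ∷ replicate c (reverse L)))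
avoids-IDI c L X 2≤c inc |X| IDI⊆
  with p , q , IDI≡ , p⊆ , q⊆ ←
         ⊆-++⁻ (concat (L ∷ L ∷ [])) (concat (replicate c (reverse L)))
               (subst (IDI X ⊆_) (sym (concat-++ (L ∷ L ∷ []) (replicate c (reverse L)))) IDI⊆) =
  IDI-cut X {p} {q} 2≤c |X| IDI≡ ascents-p descents-q
  where
  ascents-p : nonAscents p ≤ 1
  ascents-p = countAdjacent-blocks (flip _≤?_) (L ∷ L ∷ []) (no-ascent ∷ no-ascent ∷ []) p⊆
    where
    no-ascent : AllPairs (λ x y → ¬ y ≤ x) L
    no-ascent = AllPairs.map <⇒≱ inc
  descents-q : nonDescents q ≤ pred c
  descents-q = subst (λ n → nonDescents q ≤ pred n) (length-replicate c)
    (countAdjacent-blocks _≤?_ (replicate c (reverse L)) (All.replicate⁺ c no-descent) q⊆)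
    where
    no-descent : AllPairs (λ x y → ¬ x ≤ y) (reverse L)
    no-descent = AllPairs.map <⇒≱ (AllPairs-reverse⁺ inc)

IDI-not-forced : ∀ c m → 2 ≤ c → m < c + 3 → ¬ Forces (I c ++ D c ++ I c) m
IDI-not-forced c m 2≤c m<c+3 (r , forced) =
  let X , |X| , IDI⊆ = IDI-of-contains c (forced (concat (take m blocks)) formation)
  in avoids-IDI c L X 2≤c (AllPairs.applyUpTo⁺₁ (λ i → i) r (λ i<j _ → i<j)) |X|
                (⊆-trans IDI⊆ (concat-take-⊆ m blocks))
  where
  L : List ℕ
  L = upTo r
  blocks : List (List ℕ)
  blocks = L ∷ L ∷ replicate c (reverse L)
  m≤|blocks| : m ≤ length blocks
  m≤|blocks| = begin
    m                   ≤⟨ ≤-pred (subst (m <_) (+-comm c 3) m<c+3) ⟩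
    2 + c               ≡⟨ cong (2 +_) (length-replicate c) ⟨
    length blocks       ∎
    where open ≤-Reasoning
  formation : IsFormation r m (concat (take m blocks))
  formation = L , Unique.upTo⁺ r , length-upTo r , take m blocks ,
              trans (length-take m blocks) (m≤n⇒m⊓n≡m m≤|blocks|) ,
              All.take⁺ m (↭-refl ∷ ↭-refl ∷ All.replicate⁺ c (↭-reverse L)) , refl

theorem5p1 : (c : ℕ) → 2 ≤ c → FormationWidth (I c ++ D c ++ I c) (c + 3)
theorem5p1 c 2≤c = IDI-forced c , λ m m<c+3 → IDI-not-forced c m 2≤c m<c+3
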